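{- Let $(G,\gamma)$ be a colored graph and $(G',\gamma)$ a subgraph. Let $ij$ be a colored edge not in $E(G)$ with endpoints in $V(G)$, such that $\mathrm{rk}(G+ij,\gamma)>\mathrm{rk}(G,\gamma)$, and suppose $i$ and $j$ both lie in a single connected component of $G'$. Then $\mathrm{rk}(G'+ij,\gamma)>\mathrm{rk}(G',\gamma)$.
   Context: A colored graph $(G,\gamma)$ is a finite directed multigraph (parallel edges and self-loops allowed; a self-loop counts as a cycle) with a color $\gamma_{ij}\in\mathbb{Z}^2$ on each edge $ij$. Subgraphs are edge-induced with inherited colors. For a simple cycle $C$ with a traversal order, $\rho(C)=\sum_{ij\text{ traversed }i\to j}\gamma_{ij}-\sum_{ij\text{ traversed }j\to i}\gamma_{ij}$. The $\mathbb{Z}^2$-rank $\mathrm{rk}(G,\gamma)$ is the rank of the subgroup of $\mathbb{Z}^2$ generated by all $\rho(C)$. -}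

module Defs where

open import Data.Nat as ℕ using (ℕ; zero; suc; _≤_; _<_)
open import Data.Nat.Properties using (_<?_)
open import Data.Integer as ℤ using (ℤ)
open import Data.Fin using (Fin; zero; suc; toℕ; fromℕ<)
open import Data.Bool using (Bool; true; false; if_then_else_)
open import Data.Product using (Σ; Σ-syntax; ∃; ∃-syntax; _×_; _,_)
open import Data.Sum using (_⊎_)
open import Data.List using (List; []; _∷_)
open import Function.Definitions using (Injective)
open import Relation.Nullary using (yes; no)
open import Relation.Binary.PropositionalEquality using (_≡_)

ℤ² : Set
ℤ² = ℤ × ℤ

0² : ℤ²
0² = ℤ.0ℤ , ℤ.0ℤ

_+²_ : ℤ² → ℤ² → ℤ²
(a , b) +² (c , d) = (a ℤ.+ c) , (b ℤ.+ d)

-²_ : ℤ² → ℤ²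
-² (a , b) = ℤ.- a , ℤ.- b

_·²_ : ℤ → ℤ² → ℤ²
k ·² (a , b) = (k ℤ.* a) , (k ℤ.* b)

sum² : ∀ {k} → (Fin k → ℤ²) → ℤ²
sum² {zero}  f = 0²
sum² {suc k} f = f zero +² sum² (λ t → f (suc t))

-- Colored graphs: finite directed multigraphs (parallel edges and
-- self-loops allowed) with vertex set Fin n, edge set Fin m, each edge
-- e going from src e to tgt e and carrying a color col e ∈ ℤ².

record ColoredGraph : Set where
  field
    nV  : ℕ
    nE  : ℕ
    src : Fin nE → Fin nV
    tgt : Fin nE → Fin nV
    col : Fin nE → ℤ²
open ColoredGraph public

-- An (edge-induced) subgraph is given by its set of edges; colors
-- are inherited.
EdgeSet : ColoredGraph → Set
EdgeSet G = Fin (nE G) → Bool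

allEdges : (G : ColoredGraph) → EdgeSet G
allEdges G e = true

InV : (G : ColoredGraph) → EdgeSet G → Fin (nV G) → Set
InV G S v = ∃[ e ] (S e ≡ true × (src G e ≡ v ⊎ tgt G e ≡ v))

-- A simple cycle of length k+1 is given by distinct vertices
-- v 0, …, v k and distinct edges e 0, …, e k, where edge e t joins
-- v t and v (next t) (indices mod k+1), traversed forwards
-- (src → tgt) if dir t = true and backwards otherwise.

next : ∀ {k} → Fin (suc k) → Fin (suc k)
next {k} t with suc (toℕ t) <? suc k
... | yes p = fromℕ< p
... | no  _ = zero

record SimpleCycle (G : ColoredGraph) (S : EdgeSet G) : Set where
  field
    len-1  : ℕ
    vert   : Fin (suc len-1) → Fin (nV G)
    edge   : Fin (suc len-1) → Fin (nE G)
    dir    : Fin (suc len-1) → Bool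
    vert-inj : Injective _≡_ _≡_ vert
    edge-inj : Injective _≡_ _≡_ edge
    inS    : ∀ t → S (edge t) ≡ true
    joins  : ∀ t → if dir t
                   then (src G (edge t) ≡ vert t × tgt G (edge t) ≡ vert (next t))
                   else (tgt G (edge t) ≡ vert t × src G (edge t) ≡ vert (next t))

ρ : {G : ColoredGraph} {S : EdgeSet G} → SimpleCycle G S → ℤ²
ρ {G} C = sum² (λ t → if dir t then col G (edge t) else -² col G (edge t))
  where open SimpleCycle C

lincomb : {G : ColoredGraph} {S : EdgeSet G} → List (ℤ × SimpleCycle G S) → ℤ²
lincomb []             = 0²
lincomb ((a , C) ∷ xs) = (a ·² ρ C) +² lincomb xs

InCycleGroup : (G : ColoredGraph) → EdgeSet G → ℤ² → Set
InCycleGroup G S w = ∃[ xs ] (lincomb {G} {S} xs ≡ w)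

LinIndep : ∀ {k} → (Fin k → ℤ²) → Set
LinIndep {k} f = (c : Fin k → ℤ) → sum² (λ t → c t ·² f t) ≡ 0² → ∀ t → c t ≡ ℤ.0ℤ

IsRank : (ℤ² → Set) → ℕ → Set
IsRank H r =
  (Σ[ f ∈ (Fin r → ℤ²) ] ((∀ t → H (f t)) × LinIndep f)) ×
  (∀ k (f : Fin k → ℤ²) → (∀ t → H (f t)) → LinIndep f → k ≤ r)

HasRk : (G : ColoredGraph) → EdgeSet G → ℕ → Set
HasRk G S r = IsRank (InCycleGroup G S) r

data Reach (G : ColoredGraph) (S : EdgeSet G) : Fin (nV G) → Fin (nV G) → Set where
  here : ∀ {v} → Reach G S v v
  fwd  : ∀ {v} e → S e ≡ true → Reach G S (tgt G e) v → Reach G S (src G e) v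
  bwd  : ∀ {v} e → S e ≡ true → Reach G S (src G e) v → Reach G S (tgt G e) v

SameComponent : (G : ColoredGraph) → EdgeSet G → Fin (nV G) → Fin (nV G) → Set
SameComponent G S u v = InV G S u × InV G S v × Reach G S u v

addEdge : (G : ColoredGraph) → Fin (nV G) → Fin (nV G) → ℤ² → ColoredGraph
addEdge G i j c = record
  { nV  = nV G
  ; nE  = suc (nE G)
  ; src = λ { zero → i ; (suc e) → src G e }
  ; tgt = λ { zero → j ; (suc e) → tgt G e }
  ; col = λ { zero → c ; (suc e) → col G e }
  }

addEdgeSet : (G : ColoredGraph) (i j : Fin (nV G)) (c : ℤ²) → EdgeSet G → EdgeSet (addEdge G i j c)
addEdgeSet G i j c S zero    = true
addEdgeSet G i j c S (suc e) = S e

module Submission where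

-- Proof idea.  Write H(S) for the cycle group of a subgraph S, i.e. the
-- submodule of ℤ² generated by the values ρ(C) of its simple cycles.
--
--  * H(S) is exactly the set of values of closed walks in S: a closed walk
--    is cut at its first repeated vertex into a simple cycle (or a
--    back-and-forth step of value 0) and a shorter walk.  Consequently
--    H(S) is functorial along color-preserving graph homomorphisms.
--  * Let P be a walk from i to j in G' and δ = -c + val(P), the value of
--    the closed walk "new edge backwards, then P".  Then δ ∈ H(G'+ij), and
--    every walk in G+ij can be rerouted through P, so its value lies in
--    H(G) + ℤδ.  Hence if dδ ∈ H(G) for some d ≠ 0, then d·H(G+ij) ⊆ H(G)
--    and rk(G+ij) ≤ rk(G), against the hypothesis.  So no nonzero multiple
--    of δ lies in H(G) ⊇ H(G').
--  * A maximal independent family of H(G') extended by δ is then an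
--    independent family in H(G'+ij), so rk(G') + 1 ≤ rk(G'+ij).

open import Defs
open import Data.Nat using (ℕ; zero; suc; _≤_; _<_; s≤s)
import Data.Nat.Properties as ℕP
open import Data.Integer as ℤ using (ℤ)
import Data.Integer.Properties as ℤP
open import Data.Integer.Tactic.RingSolver using (solve-∀)
open import Data.Fin as F using (Fin; zero; suc; toℕ; fromℕ; inject₁)
import Data.Fin.Properties as FP
import Data.Vec.Functional as Vec
open import Data.Bool using (Bool; true; false; if_then_else_; not)
open import Data.Product using (Σ; _×_; _,_; proj₁; proj₂; map₁)
open import Data.Sum using (_⊎_; inj₁; inj₂)
open import Data.List using (List; []; _∷_; _++_; map)
open import Data.Empty using (⊥-elim)
open import Relation.Nullary using (yes; no)
open import Relation.Binary.PropositionalEquality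
open import Function using (id)
open import Function.Definitions using (Injective)

infixr 4 _,≡_
_,≡_ : ∀ {a b c d : ℤ} → a ≡ c → b ≡ d → (a , b) ≡ (c , d)
_,≡_ = cong₂ _,_

+²-assoc : ∀ x y z → (x +² y) +² z ≡ x +² (y +² z)
+²-assoc (a , a') (b , b') (c , c') = ℤP.+-assoc a b c ,≡ ℤP.+-assoc a' b' c'

+²-comm : ∀ x y → x +² y ≡ y +² x
+²-comm (a , a') (b , b') = ℤP.+-comm a b ,≡ ℤP.+-comm a' b'

+²-identityˡ : ∀ x → 0² +² x ≡ x
+²-identityˡ (a , a') = ℤP.+-identityˡ a ,≡ ℤP.+-identityˡ a'

+²-identityʳ : ∀ x → x +² 0² ≡ x
+²-identityʳ (a , a') = ℤP.+-identityʳ a ,≡ ℤP.+-identityʳ a'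

+²-inverseʳ : ∀ x → x +² (-² x) ≡ 0²
+²-inverseʳ (a , a') = ℤP.+-inverseʳ a ,≡ ℤP.+-inverseʳ a'

-²-involutive : ∀ x → -² (-² x) ≡ x
-²-involutive (a , a') = ℤP.neg-involutive a ,≡ ℤP.neg-involutive a'

-²-distrib : ∀ x y → -² (x +² y) ≡ (-² x) +² (-² y)
-²-distrib (a , a') (b , b') = ℤP.neg-distrib-+ a b ,≡ ℤP.neg-distrib-+ a' b'

·²-distrib : ∀ k x y → k ·² (x +² y) ≡ (k ·² x) +² (k ·² y)
·²-distrib k (a , a') (b , b') = ℤP.*-distribˡ-+ k a b ,≡ ℤP.*-distribˡ-+ k a' b'

·²-assoc : ∀ k m x → k ·² (m ·² x) ≡ (k ℤ.* m) ·² x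
·²-assoc k m (a , a') = sym (ℤP.*-assoc k m a) ,≡ sym (ℤP.*-assoc k m a')

·²-comm : ∀ k m x → k ·² (m ·² x) ≡ m ·² (k ·² x)
·²-comm k m x = begin
  k ·² (m ·² x)     ≡⟨ ·²-assoc k m x ⟩
  (k ℤ.* m) ·² x    ≡⟨ cong (_·² x) (ℤP.*-comm k m) ⟩
  (m ℤ.* k) ·² x    ≡⟨ ·²-assoc m k x ⟨
  m ·² (k ·² x)     ∎
  where open ≡-Reasoning

·²-identity : ∀ x → ℤ.1ℤ ·² x ≡ x
·²-identity (a , a') = ℤP.*-identityˡ a ,≡ ℤP.*-identityˡ a'

·²-zeroˡ : ∀ x → ℤ.0ℤ ·² x ≡ 0²
·²-zeroˡ (a , a') = ℤP.*-zeroˡ a ,≡ ℤP.*-zeroˡ a'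

·²-zeroʳ : ∀ k → k ·² 0² ≡ 0²
·²-zeroʳ k = ℤP.*-zeroʳ k ,≡ ℤP.*-zeroʳ k

·²-neg : ∀ x → ℤ.-1ℤ ·² x ≡ -² x
·²-neg (a , a') = ℤP.-1*i≡-i a ,≡ ℤP.-1*i≡-i a'

+²-rotate : ∀ a b c d → a +² ((b +² c) +² d) ≡ c +² ((a +² b) +² d)
+²-rotate (a , a') (b , b') (c , c') (d , d') = law a b c d ,≡ law a' b' c' d'
  where
  law : ∀ a b c d → a ℤ.+ ((b ℤ.+ c) ℤ.+ d) ≡ c ℤ.+ ((a ℤ.+ b) ℤ.+ d)
  law = solve-∀

-- With δ = -c + p, the value c equals p - δ and -c equals -p + δ; this
-- is how a traversal of a new edge of color c is traded for a walk of value p.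
trade₊ : ∀ c p x n → c +² (x +² (n ·² ((-² c) +² p))) ≡ (p +² x) +² ((n ℤ.+ ℤ.-1ℤ) ·² ((-² c) +² p))
trade₊ (c , c') (p , p') (x , x') n = law c p x n ,≡ law c' p' x' n
  where
  law : ∀ c p x n → c ℤ.+ (x ℤ.+ n ℤ.* (ℤ.- c ℤ.+ p)) ≡ (p ℤ.+ x) ℤ.+ (n ℤ.+ ℤ.-1ℤ) ℤ.* (ℤ.- c ℤ.+ p)
  law = solve-∀

trade₋ : ∀ c p x n → (-² c) +² (x +² (n ·² ((-² c) +² p))) ≡ ((-² p) +² x) +² ((n ℤ.+ ℤ.1ℤ) ·² ((-² c) +² p))
trade₋ (c , c') (p , p') (x , x') n = law c p x n ,≡ law c' p' x' n
  where
  law : ∀ c p x n → ℤ.- c ℤ.+ (x ℤ.+ n ℤ.* (ℤ.- c ℤ.+ p)) ≡ (ℤ.- p ℤ.+ x) ℤ.+ (n ℤ.+ ℤ.1ℤ) ℤ.* (ℤ.- c ℤ.+ p)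
  law = solve-∀

+²≡0⇒≡-² : ∀ x y → x +² y ≡ 0² → x ≡ -² y
+²≡0⇒≡-² x y x+y≡0 = begin
  x                   ≡⟨ +²-identityʳ x ⟨
  x +² 0²             ≡⟨ cong (x +²_) (+²-inverseʳ y) ⟨
  x +² (y +² (-² y))  ≡⟨ +²-assoc x y (-² y) ⟨
  (x +² y) +² (-² y)  ≡⟨ cong (_+² (-² y)) x+y≡0 ⟩
  0² +² (-² y)        ≡⟨ +²-identityˡ (-² y) ⟩
  -² y                ∎
  where open ≡-Reasoning

sum²-cong : ∀ {k} {f g : Fin k → ℤ²} → (∀ t → f t ≡ g t) → sum² f ≡ sum² g
sum²-cong {zero}  f≗g = refl
sum²-cong {suc k} f≗g = cong₂ _+²_ (f≗g zero) (sum²-cong (λ t → f≗g (suc t)))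

record IsSubmodule (H : ℤ² → Set) : Set where
  field
    0∈ : H 0²
    +∈ : ∀ {x y} → H x → H y → H (x +² y)
    ·∈ : ∀ k {x} → H x → H (k ·² x)

  -∈ : ∀ {x} → H x → H (-² x)
  -∈ {x} x∈ = subst H (·²-neg x) (·∈ ℤ.-1ℤ x∈)

  combination∈ : ∀ {k} (c : Fin k → ℤ) (f : Fin k → ℤ²) → (∀ t → H (f t)) →
                 H (sum² (λ t → c t ·² f t))
  combination∈ {zero}  c f f∈ = 0∈
  combination∈ {suc k} c f f∈ =
    +∈ (·∈ (c zero) (f∈ zero)) (combination∈ (λ t → c (suc t)) (λ t → f (suc t)) (λ t → f∈ (suc t)))

scaled-preimage : ∀ {H} d → IsSubmodule H → IsSubmodule (λ x → H (d ·² x))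
scaled-preimage {H} d sub = record
  { 0∈ = subst H (sym (·²-zeroʳ d)) 0∈
  ; +∈ = λ {x} {y} x∈ y∈ → subst H (sym (·²-distrib d x y)) (+∈ x∈ y∈)
  ; ·∈ = λ k {x} x∈ → subst H (·²-comm k d x) (·∈ k x∈)
  }
  where open IsSubmodule sub

module _ {K : ColoredGraph} {S : EdgeSet K} where

  private
    Combination : Set
    Combination = List (ℤ × SimpleCycle K S)

    value : Combination → ℤ²
    value = lincomb {K} {S}

    value-++ : ∀ xs ys → value (xs ++ ys) ≡ value xs +² value ys
    value-++ []             ys = sym (+²-identityˡ (value ys))
    value-++ ((a , C) ∷ xs) ys = trans (cong ((a ·² ρ C) +²_) (value-++ xs ys))
                                       (sym (+²-assoc (a ·² ρ C) (value xs) (value ys)))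

    value-scale : ∀ k xs → value (map (map₁ (k ℤ.*_)) xs) ≡ k ·² value xs
    value-scale k []             = sym (·²-zeroʳ k)
    value-scale k ((a , C) ∷ xs) =
      trans (cong₂ _+²_ (sym (·²-assoc k a (ρ C))) (value-scale k xs))
            (sym (·²-distrib k (a ·² ρ C) (value xs)))

  cycleGroup-isSubmodule : IsSubmodule (InCycleGroup K S)
  cycleGroup-isSubmodule = record
    { 0∈ = [] , refl
    ; +∈ = λ { (xs , refl) (ys , refl) → xs ++ ys , value-++ xs ys }
    ; ·∈ = λ { k (xs , refl) → map (map₁ (k ℤ.*_)) xs , value-scale k xs }
    }

  ρ∈cycleGroup : (C : SimpleCycle K S) → InCycleGroup K S (ρ C)
  ρ∈cycleGroup C = (ℤ.1ℤ , C) ∷ [] , trans (+²-identityʳ _) (·²-identity (ρ C))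

  cycleGroup-least : ∀ {P} → IsSubmodule P → (∀ C → P (ρ C)) →
                     ∀ {x} → InCycleGroup K S x → P x
  cycleGroup-least sub ρ∈P ([] , refl) = IsSubmodule.0∈ sub
  cycleGroup-least sub ρ∈P (((a , C) ∷ xs) , refl) =
    IsSubmodule.+∈ sub (IsSubmodule.·∈ sub a (ρ∈P C)) (cycleGroup-least sub ρ∈P (xs , refl))

scale-indep : ∀ {k d} (g : Fin k → ℤ²) → d ≢ ℤ.0ℤ → LinIndep g → LinIndep (λ t → d ·² g t)
scale-indep {d = d} g d≢0 g-indep c sum≡0 t =
  cancel (ℤP.i*j≡0⇒i≡0∨j≡0 (c t) (g-indep (λ s → c s ℤ.* d) rescaled t))
  where
  rescaled : sum² (λ s → (c s ℤ.* d) ·² g s) ≡ 0²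
  rescaled = trans (sum²-cong (λ s → sym (·²-assoc (c s) d (g s)))) sum≡0
  cancel : c t ≡ ℤ.0ℤ ⊎ d ≡ ℤ.0ℤ → c t ≡ ℤ.0ℤ
  cancel (inj₁ ct≡0) = ct≡0
  cancel (inj₂ d≡0)  = ⊥-elim (d≢0 d≡0)

rank-mono : ∀ {H H' : ℤ² → Set} {r r'} d → d ≢ ℤ.0ℤ → (∀ {x} → H x → H' (d ·² x)) →
            IsRank H r → IsRank H' r' → r ≤ r'
rank-mono d d≢0 scale ((g , g∈ , g-indep) , _) (_ , maximal) =
  maximal _ (λ t → d ·² g t) (λ t → scale (g∈ t)) (scale-indep g d≢0 g-indep)

extend-indep : ∀ {H k w} {f : Fin k → ℤ²} → IsSubmodule H → (∀ t → H (f t)) → LinIndep f →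
               (∀ d → H (d ·² w) → d ≡ ℤ.0ℤ) → LinIndep (w Vec.∷ f)
extend-indep {H} {w = w} {f} sub f∈ f-indep no-multiple c sum≡0 = coefficients
  where
  open IsSubmodule sub
  rest : ℤ²
  rest = sum² (λ t → c (suc t) ·² f t)
  c₀≡0 : c zero ≡ ℤ.0ℤ
  c₀≡0 = no-multiple (c zero)
           (subst H (sym (+²≡0⇒≡-² _ rest sum≡0)) (-∈ (combination∈ (λ t → c (suc t)) f f∈)))
  rest≡0 : rest ≡ 0²
  rest≡0 = begin
    rest                     ≡⟨ +²-identityˡ rest ⟨
    0² +² rest               ≡⟨ cong (λ a → (a ·² w) +² rest) c₀≡0 ⟨
    (c zero ·² w) +² rest    ≡⟨ sum≡0 ⟩
    0²                       ∎
    where open ≡-Reasoning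
  coefficients : ∀ t → c t ≡ ℤ.0ℤ
  coefficients zero    = c₀≡0
  coefficients (suc t) = f-indep (λ t → c (suc t)) rest≡0 t

next-inject₁ : ∀ {k} (t : Fin k) → next {k} (inject₁ t) ≡ suc t
next-inject₁ {k} t with suc (toℕ (inject₁ t)) ℕP.<? suc k
... | yes p = FP.toℕ-injective (trans (FP.toℕ-fromℕ< p) (cong suc (FP.toℕ-inject₁ t)))
... | no ¬p = ⊥-elim (¬p (s≤s (subst (_< k) (sym (FP.toℕ-inject₁ t)) (FP.toℕ<n t))))

next-last : ∀ k → next {k} (fromℕ k) ≡ zero
next-last k with suc (toℕ (fromℕ k)) ℕP.<? suc k
... | yes p = ⊥-elim (ℕP.<-irrefl refl (subst (λ x → suc x < suc k) (FP.toℕ-fromℕ k) p))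
... | no ¬p = refl

last-or-inject₁ : ∀ {k} (t : Fin (suc k)) → t ≡ fromℕ k ⊎ Σ (Fin k) (λ s → t ≡ inject₁ s)
last-or-inject₁ {zero}  zero    = inj₁ refl
last-or-inject₁ {suc k} zero    = inj₂ (zero , refl)
last-or-inject₁ {suc k} (suc t) with last-or-inject₁ t
... | inj₁ t≡last       = inj₁ (cong suc t≡last)
... | inj₂ (s , t≡s)    = inj₂ (suc s , cong suc t≡s)

module Traversal (K : ColoredGraph) where

  Vertex : Set
  Vertex = Fin (nV K)

  Edge : Set
  Edge = Fin (nE K)

  start end : Edge → Bool → Vertex
  start e true  = src K e
  start e false = tgt K e
  end   e true  = tgt K e
  end   e false = src K e

  gain : Edge → Bool → ℤ²
  gain e d = if d then col K e else -² col K e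

  Joins : Edge → Bool → Vertex → Vertex → Set
  Joins e d u v = if d then (src K e ≡ u × tgt K e ≡ v) else (tgt K e ≡ u × src K e ≡ v)

  Joins⇒ : ∀ e d {u v} → Joins e d u v → start e d ≡ u × end e d ≡ v
  Joins⇒ e true  j = j
  Joins⇒ e false j = j

  ⇒Joins : ∀ e d {u v} → start e d ≡ u × end e d ≡ v → Joins e d u v
  ⇒Joins e true  j = j
  ⇒Joins e false j = j

  start-not : ∀ e d → start e (not d) ≡ end e d
  start-not e true  = refl
  start-not e false = refl

  end-not : ∀ e d → end e (not d) ≡ start e d
  end-not e true  = refl
  end-not e false = refl

  endpoint : ∀ e d b → start e b ≡ start e d ⊎ start e b ≡ end e d
  endpoint e true  true  = inj₁ refl
  endpoint e true  false = inj₂ refl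
  endpoint e false true  = inj₂ refl
  endpoint e false false = inj₁ refl

  gain-not : ∀ e d → gain e (not d) ≡ -² gain e d
  gain-not e true  = refl
  gain-not e false = sym (-²-involutive (col K e))

  gain-backtrack : ∀ e d → gain e d +² gain e (not d) ≡ 0²
  gain-backtrack e d = trans (cong (gain e d +²_) (gain-not e d)) (+²-inverseʳ (gain e d))

module Walks (K : ColoredGraph) (S : EdgeSet K) where
  open Traversal K public

  H : ℤ² → Set
  H = InCycleGroup K S

  open IsSubmodule (cycleGroup-isSubmodule {K} {S})

  data Walk : Vertex → Vertex → Set where
    nil  : ∀ {u} → Walk u u
    cons : ∀ {u u' v} e d → S e ≡ true → start e d ≡ u → end e d ≡ u' → Walk u' v → Walk u v

  value : ∀ {u v} → Walk u v → ℤ²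
  value nil                = 0²
  value (cons e d _ _ _ w) = gain e d +² value w

  append : ∀ {u v x} → Walk u v → Walk v x → Walk u x
  append nil                w' = w'
  append (cons e d p q r w) w' = cons e d p q r (append w w')

  value-append : ∀ {u v x} (w : Walk u v) (w' : Walk v x) → value (append w w') ≡ value w +² value w'
  value-append nil                w' = sym (+²-identityˡ (value w'))
  value-append (cons e d p q r w) w' =
    trans (cong (gain e d +²_) (value-append w w')) (sym (+²-assoc (gain e d) (value w) (value w')))

  reverse : ∀ {u v} → Walk u v → Walk v u
  reverse nil                = nil
  reverse (cons e d p q r w) =
    append (reverse w) (cons e (not d) p (trans (start-not e d) r) (trans (end-not e d) q) nil)

  value-reverse : ∀ {u v} (w : Walk u v) → value (reverse w) ≡ -² value w
  value-reverse nil                = refl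
  value-reverse (cons e d p q r w) = begin
    value (append (reverse w) _)              ≡⟨ value-append (reverse w) _ ⟩
    value (reverse w) +² (gain e (not d) +² 0²)
      ≡⟨ cong₂ _+²_ (value-reverse w) (trans (+²-identityʳ _) (gain-not e d)) ⟩
    (-² value w) +² (-² gain e d)             ≡⟨ +²-comm (-² value w) (-² gain e d) ⟩
    (-² gain e d) +² (-² value w)             ≡⟨ -²-distrib (gain e d) (value w) ⟨
    -² (gain e d +² value w)                  ∎
    where open ≡-Reasoning

  length : ∀ {u v} → Walk u v → ℕ
  length nil                = zero
  length (cons _ _ _ _ _ w) = suc (length w)

  vertexAt : ∀ {u v} (w : Walk u v) → Fin (suc (length w)) → Vertex
  vertexAt {u} w                zero    = u
  vertexAt (cons _ _ _ _ _ w) (suc t) = vertexAt w t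

  edgeAt : ∀ {u v} (w : Walk u v) → Fin (length w) → Edge
  edgeAt (cons e _ _ _ _ _) zero    = e
  edgeAt (cons _ _ _ _ _ w) (suc t) = edgeAt w t

  dirAt : ∀ {u v} (w : Walk u v) → Fin (length w) → Bool
  dirAt (cons _ d _ _ _ _) zero    = d
  dirAt (cons _ _ _ _ _ w) (suc t) = dirAt w t

  edgeAt∈S : ∀ {u v} (w : Walk u v) t → S (edgeAt w t) ≡ true
  edgeAt∈S (cons _ _ p _ _ _) zero    = p
  edgeAt∈S (cons _ _ _ _ _ w) (suc t) = edgeAt∈S w t

  vertexAt-last : ∀ {u v} (w : Walk u v) → vertexAt w (fromℕ (length w)) ≡ v
  vertexAt-last nil                = refl
  vertexAt-last (cons _ _ _ _ _ w) = vertexAt-last w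

  edgeAt-start : ∀ {u v} (w : Walk u v) t → start (edgeAt w t) (dirAt w t) ≡ vertexAt w (inject₁ t)
  edgeAt-start (cons _ _ _ q _ _) zero    = q
  edgeAt-start (cons _ _ _ _ _ w) (suc t) = edgeAt-start w t

  edgeAt-end : ∀ {u v} (w : Walk u v) t → end (edgeAt w t) (dirAt w t) ≡ vertexAt w (suc t)
  edgeAt-end (cons _ _ _ _ r _) zero    = r
  edgeAt-end (cons _ _ _ _ _ w) (suc t) = edgeAt-end w t

  edgeAt-endpoint : ∀ {u v} (w : Walk u v) t b → Σ (Fin (suc (length w))) λ s → start (edgeAt w t) b ≡ vertexAt w s
  edgeAt-endpoint w t b with endpoint (edgeAt w t) (dirAt w t) b
  ... | inj₁ eq = inject₁ t , trans eq (edgeAt-start w t)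
  ... | inj₂ eq = suc t , trans eq (edgeAt-end w t)

  value-as-sum : ∀ {u v} (w : Walk u v) → value w ≡ sum² (λ t → gain (edgeAt w t) (dirAt w t))
  value-as-sum nil                = refl
  value-as-sum (cons e d _ _ _ w) = cong (gain e d +²_) (value-as-sum w)

  data IsPath : ∀ {u v} → Walk u v → Set where
    nilP  : ∀ {u} → IsPath (nil {u})
    consP : ∀ {u u' v e d p q r} {w : Walk u' v} →
            (∀ t → vertexAt w t ≢ u) → (∀ t → edgeAt w t ≢ e) → IsPath w →
            IsPath (cons {u} e d p q r w)

  path-vertex-inj : ∀ {u v} {w : Walk u v} → IsPath w → Injective _≡_ _≡_ (vertexAt w)
  path-vertex-inj P                 {zero}  {zero}  eq = refl
  path-vertex-inj (consP fresh _ _) {zero}  {suc t} eq = ⊥-elim (fresh t (sym eq))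
  path-vertex-inj (consP fresh _ _) {suc s} {zero}  eq = ⊥-elim (fresh s eq)
  path-vertex-inj (consP _ _ P)     {suc s} {suc t} eq = cong suc (path-vertex-inj P eq)

  path-edge-inj : ∀ {u v} {w : Walk u v} → IsPath w → Injective _≡_ _≡_ (edgeAt w)
  path-edge-inj (consP _ _ _)     {zero}  {zero}  eq = refl
  path-edge-inj (consP _ fresh _) {zero}  {suc t} eq = ⊥-elim (fresh t (sym eq))
  path-edge-inj (consP _ fresh _) {suc s} {zero}  eq = ⊥-elim (fresh s eq)
  path-edge-inj (consP _ _ P)     {suc s} {suc t} eq = cong suc (path-edge-inj P eq)

  -- a closed path is empty
  closed-path-value : ∀ {u v} (w : Walk u v) → IsPath w → u ≡ v → value w ≡ 0²
  closed-path-value nil                _                 _   = refl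
  closed-path-value (cons _ _ _ _ _ w) (consP fresh _ _) u≡v =
    ⊥-elim (fresh (fromℕ (length w)) (trans (vertexAt-last w) (sym u≡v)))

  locate : ∀ {u v} (w : Walk u v) x → (Σ _ λ t → vertexAt w t ≡ x) ⊎ (∀ t → vertexAt w t ≢ x)
  locate {u} w x with u F.≟ x
  ... | yes u≡x = inj₁ (zero , u≡x)
  locate nil                x | no u≢x = inj₂ λ { zero → u≢x }
  locate (cons _ _ _ _ _ w) x | no u≢x with locate w x
  ... | inj₁ (t , eq) = inj₁ (suc t , eq)
  ... | inj₂ absent   = inj₂ λ { zero → u≢x ; (suc t) → absent t }

  record Cut {u v} (w : Walk u v) (x : Vertex) : Set where
    field
      before       : Walk u x
      after        : Walk x v
      before-path  : IsPath before
      after-path   : IsPath after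
      before-vertices : ∀ s → Σ _ λ s' → vertexAt before s ≡ vertexAt w s'
      before-edges    : ∀ s → Σ _ λ s' → edgeAt before s ≡ edgeAt w s'
      value-cut    : value w ≡ value before +² value after

  cut : ∀ {u v x} (w : Walk u v) → IsPath w → ∀ t → vertexAt w t ≡ x → Cut w x
  cut w P zero refl = record
    { before = nil ; after = w ; before-path = nilP ; after-path = P
    ; before-vertices = λ { zero → zero , refl } ; before-edges = λ ()
    ; value-cut = sym (+²-identityˡ (value w)) }
  cut (cons e d p q r w) (consP vfresh efresh P) (suc t) eq = record
    { before = cons e d p q r before
    ; after = after
    ; before-path = consP (λ s eq' → vfresh (proj₁ (before-vertices s)) (trans (sym (proj₂ (before-vertices s))) eq'))
                          (λ s eq' → efresh (proj₁ (before-edges s)) (trans (sym (proj₂ (before-edges s))) eq'))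
                          before-path
    ; after-path = after-path
    ; before-vertices = λ { zero → zero , refl
                          ; (suc s) → suc (proj₁ (before-vertices s)) , proj₂ (before-vertices s) }
    ; before-edges = λ { zero → zero , refl
                       ; (suc s) → suc (proj₁ (before-edges s)) , proj₂ (before-edges s) }
    ; value-cut = trans (cong (gain e d +²_) value-cut)
                        (sym (+²-assoc (gain e d) (value before) (value after))) }
    where open Cut (cut w P t eq)

  closing-cycle : ∀ {u u₁} e d (p : S e ≡ true) (q : start e d ≡ u) (r : end e d ≡ u₁) (Q : Walk u₁ u) →
                  IsPath Q → (∀ s → edgeAt Q s ≢ e) →
                  Σ (SimpleCycle K S) λ C → ρ C ≡ value (cons e d p q r Q)
  closing-cycle {u} e d p q r Q P e-fresh =
    record { len-1 = length Q ; vert = λ t → vertexAt C (inject₁ t) ; edge = edgeAt C ; dir = dirAt C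
           ; vert-inj = vertex-inj ; edge-inj = edge-inj ; inS = edgeAt∈S C
           ; joins = λ t → ⇒Joins (edgeAt C t) (dirAt C t) (edgeAt-start C t , trans (edgeAt-end C t) (wraps t)) }
    , sym (value-as-sum C)
    where
    C : Walk u u
    C = cons e d p q r Q

    wraps : ∀ t → vertexAt C (suc t) ≡ vertexAt C (inject₁ (next t))
    wraps t with last-or-inject₁ t
    ... | inj₁ refl       = trans (vertexAt-last C) (cong (λ z → vertexAt C (inject₁ z)) (sym (next-last (length Q))))
    ... | inj₂ (s , refl) = cong (λ z → vertexAt C (inject₁ z)) (sym (next-inject₁ s))

    u-last : ∀ s → u ≢ vertexAt Q (inject₁ s)
    u-last s eq = FP.fromℕ≢inject₁ {i = s} (path-vertex-inj P (trans (vertexAt-last Q) eq))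

    vertex-inj : Injective _≡_ _≡_ (λ t → vertexAt C (inject₁ t))
    vertex-inj {zero}  {zero}   _  = refl
    vertex-inj {zero}  {suc s}  eq = ⊥-elim (u-last s eq)
    vertex-inj {suc s} {zero}   eq = ⊥-elim (u-last s (sym eq))
    vertex-inj {suc s} {suc s'} eq = cong suc (FP.inject₁-injective (path-vertex-inj P eq))

    edge-inj : Injective _≡_ _≡_ (edgeAt C)
    edge-inj {zero}  {zero}   _  = refl
    edge-inj {zero}  {suc s}  eq = ⊥-elim (e-fresh s (sym eq))
    edge-inj {suc s} {zero}   eq = ⊥-elim (e-fresh s eq)
    edge-inj {suc s} {suc s'} eq = cong suc (path-edge-inj P eq)

  cycle∈ : ∀ {x} → Σ (SimpleCycle K S) (λ C → ρ C ≡ x) → H x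
  cycle∈ (C , ρC≡x) = subst H ρC≡x (ρ∈cycleGroup C)

  backtrack∈ : ∀ {u v} e d (Q : Walk u v) → value Q ≡ 0² → H (gain e d +² (gain e (not d) +² value Q))
  backtrack∈ e d Q Q≡0 = subst H (sym (begin
    gain e d +² (gain e (not d) +² value Q)  ≡⟨ cong (λ z → gain e d +² (gain e (not d) +² z)) Q≡0 ⟩
    gain e d +² (gain e (not d) +² 0²)       ≡⟨ cong (gain e d +²_) (+²-identityʳ _) ⟩
    gain e d +² gain e (not d)               ≡⟨ gain-backtrack e d ⟩
    0²                                       ∎)) 0∈
    where open ≡-Reasoning

  -- Closing a path Q by an edge e gives an element of the cycle group: a
  -- simple cycle, or, if Q starts by going back along e, the value 0.
  closing∈ : ∀ {u u₁} e d (p : S e ≡ true) (q : start e d ≡ u) (r : end e d ≡ u₁) (Q : Walk u₁ u) →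
             IsPath Q → H (gain e d +² value Q)
  closing∈ e d p q r nil P = cycle∈ (closing-cycle e d p q r nil P λ ())
  closing∈ e d p q r Q@(cons e₀ _ _ _ _ Q') P@(consP vfresh _ _) with e₀ F.≟ e
  ... | no e₀≢e = cycle∈ (closing-cycle e d p q r Q P e-fresh)
    where
    e-fresh : ∀ s → edgeAt Q s ≢ e
    e-fresh zero    = e₀≢e
    e-fresh (suc s) eq with edgeAt-endpoint Q' s (not d)
    ... | s' , eq' = vfresh s' (trans (sym eq') (trans (cong (λ z → start z (not d)) eq) (trans (start-not e d) r)))
  closing∈ e true  p q r (cons e₀ true  _ q₀ _ Q') (consP vfresh _ _) | yes refl =
    ⊥-elim (vfresh (fromℕ (length Q')) (trans (vertexAt-last Q') (trans (sym q) q₀)))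
  closing∈ e false p q r (cons e₀ false _ q₀ _ Q') (consP vfresh _ _) | yes refl =
    ⊥-elim (vfresh (fromℕ (length Q')) (trans (vertexAt-last Q') (trans (sym q) q₀)))
  closing∈ e true  p q r (cons e₀ false _ _ r₀ Q') (consP _ _ P') | yes refl =
    backtrack∈ e true Q' (closed-path-value Q' P' (trans (sym r₀) q))
  closing∈ e false p q r (cons e₀ true  _ _ r₀ Q') (consP _ _ P') | yes refl =
    backtrack∈ e false Q' (closed-path-value Q' P' (trans (sym r₀) q))

  record PathDecomposition (u v : Vertex) (x : ℤ²) : Set where
    field
      path    : Walk u v
      is-path : IsPath path
      rest    : ℤ²
      rest∈   : H rest
      splits  : x ≡ value path +² rest

  -- Prepend the edges one by one; whenever the path so far returns to the
  -- new start vertex, the loop it closes is moved into the cycle group.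
  decompose : ∀ {u v} (w : Walk u v) → PathDecomposition u v (value w)
  decompose nil = record
    { path = nil ; is-path = nilP ; rest = 0² ; rest∈ = 0∈ ; splits = sym (+²-identityˡ 0²) }
  decompose {u} (cons e d p q r w) with decompose w
  ... | record { path = Q ; is-path = P ; rest = h ; rest∈ = h∈ ; splits = w≡Q+h } with locate Q u
  ...   | inj₂ u∉Q = record
    { path = cons e d p q r Q ; is-path = consP u∉Q e∉Q P ; rest = h ; rest∈ = h∈
    ; splits = trans (cong (gain e d +²_) w≡Q+h) (sym (+²-assoc (gain e d) (value Q) h)) }
    where
    e∉Q : ∀ t → edgeAt Q t ≢ e
    e∉Q t eq with edgeAt-endpoint Q t d
    ... | s , eq' = u∉Q s (trans (sym eq') (trans (cong (λ z → start z d) eq) q))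
  ...   | inj₁ (t , Qt≡u) = record
    { path = after ; is-path = after-path ; rest = (gain e d +² value before) +² h
    ; rest∈ = +∈ (closing∈ e d p q r before before-path) h∈
    ; splits = trans (cong (gain e d +²_) (trans w≡Q+h (cong (_+² h) value-cut)))
                     (+²-rotate (gain e d) (value before) (value after) h) }
    where open Cut (cut Q P t Qt≡u)

  closedWalk∈ : ∀ {u} (w : Walk u u) → H (value w)
  closedWalk∈ w = subst H (sym (begin
    value w                ≡⟨ splits ⟩
    value path +² rest     ≡⟨ cong (_+² rest) (closed-path-value path is-path refl) ⟩
    0² +² rest             ≡⟨ +²-identityˡ rest ⟩
    rest                   ∎)) rest∈
    where
    open PathDecomposition (decompose w)
    open ≡-Reasoning

  walkThrough : ∀ n (es : Fin n → Edge) (ds : Fin n → Bool) (vs : Fin (suc n) → Vertex) →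
                (∀ t → S (es t) ≡ true) →
                (∀ t → start (es t) (ds t) ≡ vs (inject₁ t)) → (∀ t → end (es t) (ds t) ≡ vs (suc t)) →
                Σ (Walk (vs zero) (vs (fromℕ n))) λ w → value w ≡ sum² (λ t → gain (es t) (ds t))
  walkThrough zero    es ds vs ∈S starts ends = nil , refl
  walkThrough (suc n) es ds vs ∈S starts ends =
    cons (es zero) (ds zero) (∈S zero) (starts zero) (ends zero) (proj₁ rest) ,
    cong (gain (es zero) (ds zero) +²_) (proj₂ rest)
    where
    rest = walkThrough n (λ t → es (suc t)) (λ t → ds (suc t)) (λ t → vs (suc t))
                         (λ t → ∈S (suc t)) (λ t → starts (suc t)) (λ t → ends (suc t))

  value-subst : ∀ {u v v'} (eq : v ≡ v') (w : Walk u v) → value (subst (Walk u) eq w) ≡ value w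
  value-subst refl w = refl

  cycle-walk : (C : SimpleCycle K S) → let open SimpleCycle C in
               Σ (Walk (vert zero) (vert zero)) λ w → value w ≡ ρ C
  cycle-walk C = subst (Walk (vert zero)) closes w , trans (value-subst closes w) w≡ρ
    where
    open SimpleCycle C
    vs : Fin (suc (suc len-1)) → Vertex
    vs zero    = vert zero
    vs (suc t) = vert (next t)

    incident : ∀ t → start (edge t) (dir t) ≡ vert t × end (edge t) (dir t) ≡ vert (next t)
    incident t = Joins⇒ (edge t) (dir t) (joins t)

    starts : ∀ t → start (edge t) (dir t) ≡ vs (inject₁ t)
    starts zero    = proj₁ (incident zero)
    starts (suc t) = trans (proj₁ (incident (suc t))) (cong vert (sym (next-inject₁ t)))

    w : Walk (vert zero) (vs (fromℕ (suc len-1)))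
    w = proj₁ (walkThrough (suc len-1) edge dir vs inS starts (λ t → proj₂ (incident t)))

    w≡ρ : value w ≡ ρ C
    w≡ρ = proj₂ (walkThrough (suc len-1) edge dir vs inS starts (λ t → proj₂ (incident t)))

    closes : vs (fromℕ (suc len-1)) ≡ vert zero
    closes = cong vert (next-last len-1)

reach-walk : ∀ {K S a b} → Reach K S a b → Walks.Walk K S a b
reach-walk Reach.here        = Walks.nil
reach-walk (Reach.fwd e p r) = Walks.cons e true  p refl refl (reach-walk r)
reach-walk (Reach.bwd e p r) = Walks.cons e false p refl refl (reach-walk r)

record Hom (K : ColoredGraph) (S : EdgeSet K) (K' : ColoredGraph) (S' : EdgeSet K') : Set where
  field
    vmap     : Fin (nV K) → Fin (nV K')
    emap     : Fin (nE K) → Fin (nE K')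
    src-pres : ∀ e → src K' (emap e) ≡ vmap (src K e)
    tgt-pres : ∀ e → tgt K' (emap e) ≡ vmap (tgt K e)
    col-pres : ∀ e → col K' (emap e) ≡ col K e
    sub-pres : ∀ e → S e ≡ true → S' (emap e) ≡ true

subgraph-hom : ∀ {K} {S T : EdgeSet K} → (∀ e → S e ≡ true → T e ≡ true) → Hom K S K T
subgraph-hom S⊆T = record
  { vmap = id ; emap = id ; src-pres = λ _ → refl ; tgt-pres = λ _ → refl
  ; col-pres = λ _ → refl ; sub-pres = S⊆T }

module _ {K S K' S'} (φ : Hom K S K' S') where
  open Hom φ
  private
    module W  = Walks K S
    module W' = Walks K' S'

  start-pres : ∀ e d → W'.start (emap e) d ≡ vmap (W.start e d)
  start-pres e true  = src-pres e
  start-pres e false = tgt-pres e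

  end-pres : ∀ e d → W'.end (emap e) d ≡ vmap (W.end e d)
  end-pres e true  = tgt-pres e
  end-pres e false = src-pres e

  gain-pres : ∀ e d → W'.gain (emap e) d ≡ W.gain e d
  gain-pres e true  = col-pres e
  gain-pres e false = cong -²_ (col-pres e)

  map-walk : ∀ {u v} → W.Walk u v → W'.Walk (vmap u) (vmap v)
  map-walk W.nil                = W'.nil
  map-walk (W.cons e d p q r w) =
    W'.cons (emap e) d (sub-pres e p) (trans (start-pres e d) (cong vmap q))
            (trans (end-pres e d) (cong vmap r)) (map-walk w)

  value-map-walk : ∀ {u v} (w : W.Walk u v) → W'.value (map-walk w) ≡ W.value w
  value-map-walk W.nil                = refl
  value-map-walk (W.cons e d p q r w) = cong₂ _+²_ (gain-pres e d) (value-map-walk w)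

  -- H(S) ⊆ H(S'), as ρ(C) is the value of a closed walk
  cycleGroup-mono : ∀ {x} → InCycleGroup K S x → InCycleGroup K' S' x
  cycleGroup-mono = cycleGroup-least cycleGroup-isSubmodule cycle∈H'
    where
    cycle∈H' : (C : SimpleCycle K S) → InCycleGroup K' S' (ρ C)
    cycle∈H' C with W.cycle-walk C
    ... | w , w≡ρ = subst (InCycleGroup K' S') (trans (value-map-walk w) w≡ρ) (W'.closedWalk∈ (map-walk w))

module AddedEdge (K : ColoredGraph) (S : EdgeSet K) (i j : Fin (nV K)) (c : ℤ²) where

  K⁺ : ColoredGraph
  K⁺ = addEdge K i j c

  S⁺ : EdgeSet K⁺
  S⁺ = addEdgeSet K i j c S

  module W  = Walks K S
  module W⁺ = Walks K⁺ S⁺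

  old-edges : Hom K S K⁺ S⁺
  old-edges = record
    { vmap = id ; emap = suc ; src-pres = λ _ → refl ; tgt-pres = λ _ → refl
    ; col-pres = λ _ → refl ; sub-pres = λ _ p → p }

  -- Fix a walk P from i to j in S.  The closed walk "new edge backwards,
  -- then P" has value δ = -c + val(P).
  module Detour (P : W.Walk i j) where

    δ : ℤ²
    δ = (-² c) +² W.value P

    δ∈ : InCycleGroup K⁺ S⁺ δ
    δ∈ = subst (InCycleGroup K⁺ S⁺) (cong ((-² c) +²_) (value-map-walk old-edges P))
               (W⁺.closedWalk∈ (W⁺.cons zero false refl refl refl (map-walk old-edges P)))

    -- Replacing each traversal of the new edge by P (or its reverse)
    -- changes the value of a walk by a multiple of δ.
    reroute : ∀ {a b} (w : W⁺.Walk a b) → Σ (W.Walk a b) λ w' → Σ ℤ λ n → W⁺.value w ≡ W.value w' +² (n ·² δ)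
    reroute W⁺.nil = W.nil , ℤ.0ℤ , sym (trans (cong (0² +²_) (·²-zeroˡ δ)) (+²-identityˡ 0²))
    reroute (W⁺.cons zero true _ refl refl w) with reroute w
    ... | w' , n , w≡ = W.append P w' , n ℤ.+ ℤ.-1ℤ , (begin
      c +² W⁺.value w                                  ≡⟨ cong (c +²_) w≡ ⟩
      c +² (W.value w' +² (n ·² δ))                    ≡⟨ trade₊ c (W.value P) (W.value w') n ⟩
      (W.value P +² W.value w') +² ((n ℤ.+ ℤ.-1ℤ) ·² δ) ≡⟨ cong (_+² ((n ℤ.+ ℤ.-1ℤ) ·² δ)) (W.value-append P w') ⟨
      W.value (W.append P w') +² ((n ℤ.+ ℤ.-1ℤ) ·² δ) ∎)
      where open ≡-Reasoning
    reroute (W⁺.cons zero false _ refl refl w) with reroute w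
    ... | w' , n , w≡ = W.append (W.reverse P) w' , n ℤ.+ ℤ.1ℤ , (begin
      (-² c) +² W⁺.value w                                   ≡⟨ cong ((-² c) +²_) w≡ ⟩
      (-² c) +² (W.value w' +² (n ·² δ))                     ≡⟨ trade₋ c (W.value P) (W.value w') n ⟩
      ((-² W.value P) +² W.value w') +² ((n ℤ.+ ℤ.1ℤ) ·² δ)
        ≡⟨ cong (λ z → (z +² W.value w') +² ((n ℤ.+ ℤ.1ℤ) ·² δ)) (W.value-reverse P) ⟨
      (W.value (W.reverse P) +² W.value w') +² ((n ℤ.+ ℤ.1ℤ) ·² δ)
        ≡⟨ cong (_+² ((n ℤ.+ ℤ.1ℤ) ·² δ)) (W.value-append (W.reverse P) w') ⟨
      W.value (W.append (W.reverse P) w') +² ((n ℤ.+ ℤ.1ℤ) ·² δ) ∎)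
      where open ≡-Reasoning
    reroute (W⁺.cons (suc e) d p q r w) with reroute w
    ... | w' , n , w≡ =
      W.cons e d p (trans (sym (start-pres old-edges e d)) q) (trans (sym (end-pres old-edges e d)) r) w' , n ,
      trans (cong₂ _+²_ (gain-pres old-edges e d) w≡) (sym (+²-assoc (W.gain e d) (W.value w') (n ·² δ)))

    absorb : ∀ d → InCycleGroup K S (d ·² δ) → ∀ {x} → InCycleGroup K⁺ S⁺ x → InCycleGroup K S (d ·² x)
    absorb d dδ∈ = cycleGroup-least (scaled-preimage d cycleGroup-isSubmodule) cycle∈
      where
      open IsSubmodule (cycleGroup-isSubmodule {K} {S})
      cycle∈ : ∀ C → InCycleGroup K S (d ·² ρ C)
      cycle∈ C with W⁺.cycle-walk C
      ... | w , w≡ρ with reroute w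
      ... | w' , n , w≡ = subst (InCycleGroup K S) (begin
        (d ·² W.value w') +² (n ·² (d ·² δ))  ≡⟨ cong ((d ·² W.value w') +²_) (·²-comm n d δ) ⟩
        (d ·² W.value w') +² (d ·² (n ·² δ))  ≡⟨ ·²-distrib d (W.value w') (n ·² δ) ⟨
        d ·² (W.value w' +² (n ·² δ))         ≡⟨ cong (d ·²_) (trans (sym w≡) w≡ρ) ⟩
        d ·² ρ C                              ∎) (+∈ (·∈ d (W.closedWalk∈ w')) (·∈ n dδ∈))
        where open ≡-Reasoning

    δ-free : ∀ {r⁺ r} → IsRank (InCycleGroup K⁺ S⁺) r⁺ → IsRank (InCycleGroup K S) r → r < r⁺ →
             ∀ d → InCycleGroup K S (d ·² δ) → d ≡ ℤ.0ℤ
    δ-free rank⁺ rank r<r⁺ d dδ∈ with d ℤ.≟ ℤ.0ℤ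
    ... | yes d≡0 = d≡0
    ... | no  d≢0 = ⊥-elim (ℕP.<⇒≱ r<r⁺
                      (rank-mono {InCycleGroup K⁺ S⁺} {InCycleGroup K S} d d≢0 (absorb d dδ∈) rank⁺ rank))

lemma4 : (G : ColoredGraph) (G' : EdgeSet G) (i j : Fin (nV G)) (c : ℤ²)
         (rG+ij rG : ℕ) → HasRk (addEdge G i j c) (addEdgeSet G i j c (allEdges G)) rG+ij → HasRk G (allEdges G) rG →
         rG < rG+ij →
         SameComponent G G' i j →
         (rG'+ij rG' : ℕ) → HasRk (addEdge G i j c) (addEdgeSet G i j c G') rG'+ij → HasRk G G' rG' →
         rG' < rG'+ij
lemma4 G G' i j c rG+ij rG rank⁺ rank rG<rG+ij (_ , _ , i~j) rG'+ij rG' (_ , maximal) ((f , f∈ , f-indep) , _) =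
  maximal (suc rG') (δ Vec.∷ f) family∈ (extend-indep cycleGroup-isSubmodule f∈ f-indep δ-free-in-G')
  where
  module Sub = AddedEdge G G' i j c
  module All = AddedEdge G (allEdges G) i j c

  G'⊆G : Hom G G' G (allEdges G)
  G'⊆G = subgraph-hom (λ _ _ → refl)

  P : Sub.W.Walk i j
  P = reach-walk i~j

  open Sub.Detour P using (δ; δ∈)

  same-δ : All.Detour.δ (map-walk G'⊆G P) ≡ δ
  same-δ = cong ((-² c) +²_) (value-map-walk G'⊆G P)

  -- no nonzero multiple of δ lies in H(G'), since H(G') ⊆ H(G)
  δ-free-in-G' : ∀ d → InCycleGroup G G' (d ·² δ) → d ≡ ℤ.0ℤ
  δ-free-in-G' d dδ∈ = All.Detour.δ-free (map-walk G'⊆G P) rank⁺ rank rG<rG+ij d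
                         (subst (λ z → InCycleGroup G (allEdges G) (d ·² z)) (sym same-δ) (cycleGroup-mono G'⊆G dδ∈))

  family∈ : ∀ t → InCycleGroup (addEdge G i j c) (addEdgeSet G i j c G') ((δ Vec.∷ f) t)
  family∈ zero    = δ∈
  family∈ (suc t) = cycleGroup-mono Sub.old-edges (f∈ t)
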